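{- Let $m$ be a positive square-free integer. The affine variety $V(\sqrt m)_{1,2}\subset\mathbb{A}^3$ with coordinates $(y_1,x_1,x_2)$, defined by \[ x_1x_2-2y_1x_1=0,\qquad y_1^2x_1-y_1x_1x_2-x_2=-mx_1, \] has an integer point $(y_1,x_1,x_2)\in\mathbb{Z}^3$ with $x_1\neq0$ and $x_2\neq0$ if and only if $m=(st/2)^2+t$ for some integers $s\neq0$, $t\neq0$ with $2\mid st$.
   Context: The displayed equations are the paper's PCF variety of $(1,2)$-type for $\sqrt m$; integer points with all $x_i\ne0$ are called non-degenerate. -}

module Defs where

open import Data.Nat as ℕ using (ℕ)
open import Data.Nat.Divisibility using (_∣_)
open import Data.Integer using (ℤ; +_; _+_; _-_; _*_; -_)
open import Data.Product using (_×_)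
open import Relation.Binary.PropositionalEquality using (_≡_)

SquareFree : ℕ → Set
SquareFree m = ∀ (d : ℕ) → (d ℕ.* d) ∣ m → d ≡ 1

OnV12 : ℤ → ℤ → ℤ → ℤ → Set
OnV12 m y₁ x₁ x₂ =
  (x₁ * x₂ - (+ 2) * y₁ * x₁ ≡ + 0) ×
  (y₁ * y₁ * x₁ - y₁ * x₁ * x₂ - x₂ ≡ - (m * x₁))

{-# OPTIONS --safe #-}
-- For x₁ ≠ 0 the first equation factors as x₁ (x₂ − 2y₁) = 0, forcing x₂ = 2y₁;
-- substituting, the second equation becomes x₁ (m − y₁²) = 2y₁. So the
-- non-degenerate points are exactly (y₁, x₁, x₂) = (h, s, 2h) with t := m − h²
-- satisfying s t = 2h, and x₂ ≠ 0 amounts to t ≠ 0 once s ≠ 0.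
module Submission where

open import Defs
open import Data.Nat as ℕ using (ℕ)
open import Data.Integer using (ℤ; +_; _+_; _*_; _-_; -_; ∣_∣)
open import Data.Integer.Divisibility using (_∣_)
open import Data.Integer.Properties
  using (i*j≡0⇒i≡0∨j≡0; i-j≡0⇒i≡j; i≡j⇒i-j≡0; abs-*; *-zeroʳ)
open import Data.Integer.Tactic.RingSolver using (solve-∀)
import Data.Nat.Divisibility as ℕ
open import Data.Product using (_×_; _,_; ∃-syntax)
open import Data.Sum using ([_,_]′)
open import Function.Base using (flip)
open import Function.Bundles using (_⇔_; mk⇔; Equivalence)
open import Relation.Nullary using (contradiction)
open import Relation.Binary.PropositionalEquality
  using (_≡_; _≢_; refl; sym; trans; cong; subst)

i∣i*j : ∀ i j → i ∣ i * j
i∣i*j i j = subst (ℕ._∣_ ∣ i ∣) (sym (abs-* i j)) (ℕ.m∣m*n ∣ j ∣)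

*-≢0 : ∀ {i j} → i ≢ + 0 → j ≢ + 0 → i * j ≢ + 0
*-≢0 {i} i≢0 j≢0 ij≡0 = [ i≢0 , j≢0 ]′ (i*j≡0⇒i≡0∨j≡0 i ij≡0)

≡-via-difference : ∀ {a b c d} → a - b ≡ c - d → a ≡ b → c ≡ d
≡-via-difference {c = c} {d} diff a≡b =
  i-j≡0⇒i≡j c d (trans (sym diff) (i≡j⇒i-j≡0 a≡b))

onV12⇒x₂≡2y₁ : ∀ {m y₁ x₁ x₂} → x₁ ≢ + 0 → OnV12 m y₁ x₁ x₂ → x₂ ≡ + 2 * y₁
onV12⇒x₂≡2y₁ {m} {y₁} {x₁} {x₂} x₁≢0 (first , _) =
  [ flip contradiction x₁≢0 , i-j≡0⇒i≡j x₂ (+ 2 * y₁) ]′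
    (i*j≡0⇒i≡0∨j≡0 x₁ (trans (sym (factor x₁ x₂ y₁)) first))
  where
  factor : ∀ x₁ x₂ y₁ → x₁ * x₂ - + 2 * y₁ * x₁ ≡ x₁ * (x₂ - + 2 * y₁)
  factor = solve-∀

onV12-diagonal⇔ : ∀ m y₁ x₁ → OnV12 m y₁ x₁ (+ 2 * y₁) ⇔ x₁ * (m - y₁ * y₁) ≡ + 2 * y₁
onV12-diagonal⇔ m y₁ x₁ =
  mk⇔ (λ (_ , second) → ≡-via-difference (reduce m y₁ x₁) second)
      (λ reduced → first y₁ x₁ , ≡-via-difference (sym (reduce m y₁ x₁)) reduced)
  where
  first : ∀ y₁ x₁ → x₁ * (+ 2 * y₁) - + 2 * y₁ * x₁ ≡ + 0
  first = solve-∀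
  reduce : ∀ m y₁ x₁ → (y₁ * y₁ * x₁ - y₁ * x₁ * (+ 2 * y₁) - + 2 * y₁) - - (m * x₁)
         ≡ x₁ * (m - y₁ * y₁) - + 2 * y₁
  reduce = solve-∀

NonDegeneratePoint : ℤ → Set
NonDegeneratePoint m = ∃[ y₁ ] ∃[ x₁ ] ∃[ x₂ ] (OnV12 m y₁ x₁ x₂ × x₁ ≢ + 0 × x₂ ≢ + 0)

PCFParameters : ℤ → Set
PCFParameters m = ∃[ s ] ∃[ t ] (s ≢ + 0 × t ≢ + 0 × (+ 2) ∣ (s * t) ×
  (∃[ h ] ((s * t ≡ (+ 2) * h) × (m ≡ h * h + t))))

nonDegeneratePoint⇒pcfParameters : ∀ m → NonDegeneratePoint m → PCFParameters m
nonDegeneratePoint⇒pcfParameters m (y₁ , x₁ , x₂ , onV , x₁≢0 , x₂≢0)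
  with refl ← onV12⇒x₂≡2y₁ {m} {y₁} x₁≢0 onV =
  x₁ , t , x₁≢0 , t≢0 , subst (+ 2 ∣_) (sym x₁t≡2y₁) (i∣i*j (+ 2) y₁) ,
  y₁ , x₁t≡2y₁ , m≡y₁²+t m y₁
  where
  t : ℤ
  t = m - y₁ * y₁
  x₁t≡2y₁ : x₁ * t ≡ + 2 * y₁
  x₁t≡2y₁ = Equivalence.to (onV12-diagonal⇔ m y₁ x₁) onV
  t≢0 : t ≢ + 0
  t≢0 t≡0 = x₂≢0 (trans (sym x₁t≡2y₁) (trans (cong (x₁ *_) t≡0) (*-zeroʳ x₁)))
  m≡y₁²+t : ∀ m y₁ → m ≡ y₁ * y₁ + (m - y₁ * y₁)
  m≡y₁²+t = solve-∀

pcfParameters⇒nonDegeneratePoint : ∀ m → PCFParameters m → NonDegeneratePoint m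
pcfParameters⇒nonDegeneratePoint m (s , t , s≢0 , t≢0 , _ , h , st≡2h , refl) =
  h , s , + 2 * h ,
  Equivalence.from (onV12-diagonal⇔ (h * h + t) h s) (trans (cong (s *_) (h²+t-h²≡t h t)) st≡2h) ,
  s≢0 , subst (_≢ + 0) st≡2h (*-≢0 s≢0 t≢0)
  where
  h²+t-h²≡t : ∀ h t → h * h + t - h * h ≡ t
  h²+t-h²≡t = solve-∀

proposition3p3 : (m : ℕ) → 1 ℕ.≤ m → SquareFree m →
    (∃[ y₁ ] ∃[ x₁ ] ∃[ x₂ ] (OnV12 (+ m) y₁ x₁ x₂ × x₁ ≢ + 0 × x₂ ≢ + 0))
    ⇔
    (∃[ s ] ∃[ t ] (s ≢ + 0 × t ≢ + 0 × (+ 2) ∣ (s * t) ×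
      (∃[ h ] ((s * t ≡ (+ 2) * h) × (+ m ≡ h * h + t)))))
proposition3p3 m _ _ =
  mk⇔ (nonDegeneratePoint⇒pcfParameters (+ m)) (pcfParameters⇒nonDegeneratePoint (+ m))
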